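{- Let $k,s,f_0,f_1\in\mathbb Z$, let $(f_n)_{n\in\mathbb Z}$ be determined by $f_0,f_1$ and $f_n=kf_{n-1}-f_{n-2}$ for $n$ even, $f_n=sf_{n-1}-f_{n-2}$ for $n$ odd, and let $b_n=f_{n-1}f_n$. Then $$b_n+b_{n+1}=\begin{cases} s f_n^2 & n\text{ even},\\ k f_n^2 & n\text{ odd}.\end{cases}$$ In particular the sum of any two consecutive terms of the lens sequence $(b_n)$ is $k$ or $s$ times a perfect square.
   Context: The recurrence is applied both forwards and backwards to define $f_n$ for all $n\in\mathbb Z$. The sequence $(b_n)$ is then a lens sequence (it satisfies $b_n=(ks-2)b_{n-1}-b_{n-2}+\beta$ with $\beta=kf_1^2+sf_0^2-ksf_0f_1$). -}

module Defs where

open import Data.Integer using (ℤ; _+_; _-_; _*_; +_)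
open import Relation.Binary.PropositionalEquality using (_≡_)
open import Data.Product using (Σ; _×_)

Even : ℤ → Set
Even n = Σ ℤ (λ m → n ≡ (+ 2) * m)

Odd : ℤ → Set
Odd n = Σ ℤ (λ m → n ≡ (+ 2) * m + (+ 1))

-- f : ℤ → ℤ satisfies the alternating recurrence for every n ∈ ℤ
-- (this determines f uniquely from f 0 and f 1, applying the recurrence
-- forwards and backwards)
IsAltRec : (k s : ℤ) → (ℤ → ℤ) → Set
IsAltRec k s f =
  (∀ n → Even n → f n ≡ k * f (n - + 1) - f (n - + 2)) ×
  (∀ n → Odd n → f n ≡ s * f (n - + 1) - f (n - + 2))

lensSeq : (ℤ → ℤ) → ℤ → ℤ
lensSeq f n = f (n - + 1) * f n

{-# OPTIONS --safe #-}
module Submission where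

open import Defs
open import Data.Integer using (ℤ; _+_; _*_; +_; _-_)
open import Data.Integer.Tactic.RingSolver using (solve-∀)
open import Data.Product using (_×_; _,_)
open import Relation.Binary.PropositionalEquality using (_≡_; cong; trans)

suc-pred : ∀ n → n + + 1 - + 1 ≡ n
suc-pred = solve-∀

suc-pred-pred : ∀ n → n + + 1 - + 2 ≡ n - + 1
suc-pred-pred = solve-∀

lens-identity : ∀ t a b → a * b + b * (t * b - a) ≡ t * (b * b)
lens-identity = solve-∀

-- Substituting f_{n+1} = t f_n − f_{n−1} into b_n + b_{n+1} = f_n (f_{n−1} + f_{n+1})
-- cancels f_{n−1} and leaves t f_n².

lensSeq-suc-sum : ∀ (t : ℤ) (f : ℤ → ℤ) n →
  f (n + + 1) ≡ t * f (n + + 1 - + 1) - f (n + + 1 - + 2) →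
  lensSeq f n + lensSeq f (n + + 1) ≡ t * (f n * f n)
lensSeq-suc-sum t f n step
  rewrite suc-pred n | suc-pred-pred n | step = lens-identity t (f (n - + 1)) (f n)

even⇒odd-suc : ∀ {n} → Even n → Odd (n + + 1)
even⇒odd-suc (m , n≡2m) = m , cong (_+ + 1) n≡2m

odd⇒even-suc : ∀ {n} → Odd n → Even (n + + 1)
odd⇒even-suc (m , n≡2m+1) = m + + 1 , trans (cong (_+ + 1) n≡2m+1) (regroup m)
  where
  regroup : ∀ m → + 2 * m + + 1 + + 1 ≡ + 2 * (m + + 1)
  regroup = solve-∀

corollary5p7 : (k s : ℤ) (f : ℤ → ℤ) → IsAltRec k s f →
    (n : ℤ) →
      (Even n → lensSeq f n + lensSeq f (n + + 1) ≡ s * (f n * f n)) ×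
      (Odd n → lensSeq f n + lensSeq f (n + + 1) ≡ k * (f n * f n))
corollary5p7 k s f (even-step , odd-step) n =
  (λ n-even → lensSeq-suc-sum s f n (odd-step (n + + 1) (even⇒odd-suc n-even))) ,
  (λ n-odd → lensSeq-suc-sum k f n (even-step (n + + 1) (odd⇒even-suc n-odd)))
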